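{- Let $\Gamma$ and $\Sigma$ be regular graphs with coprime valencies, and suppose that $\Gamma$ is $R$-thin. Then for any $(u,i)\in V(\Gamma\times\Sigma)$ and any $(v,j)\in X(u,i)$, we have $i\neq j$.
   Context: Graphs are finite and simple; $\mathrm{val}(\cdot)$ denotes the valency of a regular graph and $N_\Delta(x)$ the neighbourhood of $x$ in $\Delta$. The direct product $\Gamma\times\Sigma$ has vertex set $V(\Gamma)\times V(\Sigma)$, with $(u,x)\sim(v,y)$ iff $u\sim v$ in $\Gamma$ and $x\sim y$ in $\Sigma$. A graph is $R$-thin if distinct vertices have distinct neighbourhoods. For $(u,i),(v,j)\in V(\Gamma\times\Sigma)$ put $f((u,i),(v,j))=|N_{\Gamma\times\Sigma}((u,i))\cap N_{\Gamma\times\Sigma}((v,j))|/|N_{\Gamma\times\Sigma}((u,i))|$, and $X(u,i)=\{(v,j)\in V(\Gamma\times\Sigma)\setminus\{(u,i)\}: \mathrm{val}(\Sigma)\cdot f((u,i),(v,j))\text{ is a positive integer}\}$. -}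

module Defs where

open import Level using (0ℓ)
open import Data.Nat using (ℕ; _*_; _<_; NonZero)
open import Data.Nat.GCD using (gcd)
open import Data.Product using (_×_; _,_; proj₁; proj₂; ∃; ∃-syntax)
open import Data.List using (List; length; filter; cartesianProduct)
open import Data.List.Membership.Propositional using (_∈_)
open import Data.List.Membership.Propositional.Properties using (∈-cartesianProduct⁺)
open import Data.List.Relation.Unary.Unique.Propositional using (Unique)
open import Data.List.Relation.Unary.Unique.Propositional.Properties using (cartesianProduct⁺)
open import Relation.Nullary using (¬_; Dec)
open import Relation.Nullary.Decidable using (_×-dec_)
open import Relation.Binary using (Decidable)
open import Relation.Binary.PropositionalEquality using (_≡_)
open import Function.Bundles using (_⇔_)

record Graph : Set₁ where
  field
    V        : Set
    verts    : List V
    complete : ∀ v → v ∈ verts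
    unique   : Unique verts
    _~_      : V → V → Set
    _~?_     : Decidable _~_
    ~-sym    : ∀ {x y} → x ~ y → y ~ x
    ~-irrefl : ∀ {x} → ¬ (x ~ x)

open Graph public

N : (G : Graph) → V G → List (V G)
N G x = filter (λ w → _~?_ G x w) (verts G)

commonNbrs : (G : Graph) → V G → V G → ℕ
commonNbrs G x y = length (filter (λ w → _~?_ G x w ×-dec _~?_ G y w) (verts G))

Regular : Graph → ℕ → Set
Regular G k = ∀ x → length (N G x) ≡ k

RThin : Graph → Set
RThin G = ∀ x y → (∀ w → (_~_ G x w ⇔ _~_ G y w)) → x ≡ y

_⊗_ : Graph → Graph → Graph
Γ ⊗ Σ = record
  { V        = V Γ × V Σ
  ; verts    = cartesianProduct (verts Γ) (verts Σ)
  ; complete = λ { (u , x) → ∈-cartesianProduct⁺ (complete Γ u) (complete Σ x) }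
  ; unique   = cartesianProduct⁺ (unique Γ) (unique Σ)
  ; _~_      = λ p q → _~_ Γ (proj₁ p) (proj₁ q) × _~_ Σ (proj₂ p) (proj₂ q)
  ; _~?_     = λ p q → _~?_ Γ (proj₁ p) (proj₁ q) ×-dec _~?_ Σ (proj₂ p) (proj₂ q)
  ; ~-sym    = λ { (a , b) → ~-sym Γ a , ~-sym Σ b }
  ; ~-irrefl = λ { (a , b) → ~-irrefl Γ a }
  }

-- (v,j) ∈ X(u,i) for Γ × Σ, where Σ has valency l:
-- (v,j) ≠ (u,i), f is defined (|N(u,i)| ≠ 0), and
-- l · |N(u,i) ∩ N(v,j)| / |N(u,i)| is a positive integer q.
InX : (Γ Σ : Graph) (l : ℕ) → V (Γ ⊗ Σ) → V (Γ ⊗ Σ) → Set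
InX Γ Σ l p q =
  ¬ (q ≡ p) ×
  NonZero (length (N (Γ ⊗ Σ) p)) ×
  ∃[ k ] (0 < k × l * commonNbrs (Γ ⊗ Σ) p q ≡ k * length (N (Γ ⊗ Σ) p))

module Submission where

-- If i = j, then N(u,i) ∩ N(v,i) = (N(u) ∩ N(v)) × N(i), so with c = |N(u) ∩ N(v)| the
-- X-condition reads l · c·l = m · k·l, i.e. l·c = m·k.  Coprimality of k and l gives k ∣ c,
-- while c ≤ k; hence c = k, so u and v have the same k neighbours and R-thinness forces u = v.

open import Defs
open import Data.Nat using (ℕ; zero; suc; _+_; _*_; _≤_; _<_; NonZero; >-nonZero)
open import Data.Nat.GCD using (gcd)
open import Data.Nat.Properties using (*-assoc; *-cancelʳ-≡; ≤-antisym; n≤0⇒n≡0; m*n≢0; m*n≢0⇒n≢0)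
open import Data.Nat.Divisibility using (_∣_; divides; ∣⇒≤)
open import Data.Nat.Coprimality using (Coprime; gcd≡1⇒coprime; coprime-divisor)
open import Data.Product using (_×_; _,_; proj₁; proj₂; swap)
open import Data.Bool using (true; false)
open import Data.List using (List; []; _∷_; _++_; map; length; filter; cartesianProduct)
open import Data.List.Properties
  using (length-++; length-map; length-filter; filter-++; filter-≐; filter-idem; filter-none; filter-complete)
open import Data.List.Membership.Propositional using (_∈_)
open import Data.List.Membership.Propositional.Properties using (∈-filter⁺; ∈-filter⁻)
import Data.List.Relation.Unary.All as All
open import Level using (Level)
open import Relation.Binary.PropositionalEquality
  using (_≡_; refl; sym; trans; cong; cong₂; subst; subst₂; module ≡-Reasoning)
open import Relation.Nullary using (¬_; yes; no; does)
open import Relation.Nullary.Decidable using (_×-dec_)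
open import Relation.Unary using (Pred; Decidable)
open import Function.Base using (_∘_)
open import Function.Bundles using (_⇔_; mk⇔)

private
  variable
    a b p q : Level
    A : Set a
    B : Set b

module _ {P : Pred A p} {Q : Pred A q} (P? : Decidable P) (Q? : Decidable Q) where

  filter-×-dec : ∀ xs → filter (λ x → P? x ×-dec Q? x) xs ≡ filter Q? (filter P? xs)
  filter-×-dec []       = refl
  filter-×-dec (x ∷ xs) with does (P? x)
  ... | false = filter-×-dec xs
  ... | true with does (Q? x)
  ...   | true  = cong (x ∷_) (filter-×-dec xs)
  ...   | false = filter-×-dec xs

filter-map : {P : Pred B p} (P? : Decidable P) (f : A → B) →
             ∀ xs → filter P? (map f xs) ≡ map f (filter (λ x → P? (f x)) xs)
filter-map P? f []       = refl
filter-map P? f (x ∷ xs) with P? (f x)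
... | yes _ = cong (f x ∷_) (filter-map P? f xs)
... | no  _ = filter-map P? f xs

length-cartesianProduct : (xs : List A) (ys : List B) →
                          length (cartesianProduct xs ys) ≡ length xs * length ys
length-cartesianProduct []       ys = refl
length-cartesianProduct (x ∷ xs) ys = begin
  length (map (x ,_) ys ++ cartesianProduct xs ys)
    ≡⟨ length-++ (map (x ,_) ys) ⟩
  length (map (x ,_) ys) + length (cartesianProduct xs ys)
    ≡⟨ cong₂ _+_ (length-map (x ,_) ys) (length-cartesianProduct xs ys) ⟩
  length ys + length xs * length ys
    ∎
  where open ≡-Reasoning

module _ {P : Pred A p} {Q : Pred B q} (P? : Decidable P) (Q? : Decidable Q) where

  private
    P×Q? : Decidable (λ z → P (proj₁ z) × Q (proj₂ z))
    P×Q? z = P? (proj₁ z) ×-dec Q? (proj₂ z)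

  filter-cartesianProduct : ∀ xs ys → filter P×Q? (cartesianProduct xs ys)
                                      ≡ cartesianProduct (filter P? xs) (filter Q? ys)
  filter-cartesianProduct []       ys = refl
  filter-cartesianProduct (x ∷ xs) ys with P? x
  ... | yes px = trans (filter-++ P×Q? (map (x ,_) ys) _) (cong₂ _++_
    (trans (filter-map P×Q? (x ,_) ys) (cong (map (x ,_)) (filter-≐ _ Q? (proj₂ , (px ,_)) ys)))
    (filter-cartesianProduct xs ys))
  ... | no ¬px = trans (filter-++ P×Q? (map (x ,_) ys) _) (cong₂ _++_
    (trans (filter-map P×Q? (x ,_) ys) (cong (map (x ,_)) (filter-none _ (All.universal (λ _ → ¬px ∘ proj₁) ys))))
    (filter-cartesianProduct xs ys))

coprime-multiple-≤⇒≡ : ∀ {k l c m} → Coprime k l → 0 < m → l * c ≡ m * k → c ≤ k → c ≡ k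
coprime-multiple-≤⇒≡ {zero}          _   _   _     c≤0 = n≤0⇒n≡0 c≤0
coprime-multiple-≤⇒≡ {k@(suc _)} {l} {c} {m} k⊥l m>0 lc≡mk c≤k = ≤-antisym c≤k (∣⇒≤ ⦃ c≢0 ⦄ k∣c)
  where
  k∣c : k ∣ c
  k∣c = coprime-divisor k⊥l (divides m lc≡mk)
  c≢0 : NonZero c
  c≢0 = m*n≢0⇒n≢0 l ⦃ subst NonZero (sym lc≡mk) (m*n≢0 m k ⦃ >-nonZero m>0 ⦄) ⦄

module _ (G : Graph) where

  commonNbrs≡length-filter-N : ∀ x y → commonNbrs G x y ≡ length (filter (_~?_ G y) (N G x))
  commonNbrs≡length-filter-N x y = cong length (filter-×-dec (_~?_ G x) (_~?_ G y) (verts G))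

  commonNbrs≤length-N : ∀ x y → commonNbrs G x y ≤ length (N G x)
  commonNbrs≤length-N x y =
    subst (_≤ length (N G x)) (sym (commonNbrs≡length-filter-N x y)) (length-filter (_~?_ G y) (N G x))

  commonNbrs-self : ∀ x → commonNbrs G x x ≡ length (N G x)
  commonNbrs-self x = trans (commonNbrs≡length-filter-N x x) (cong length (filter-idem (_~?_ G x) (verts G)))

  commonNbrs-comm : ∀ x y → commonNbrs G x y ≡ commonNbrs G y x
  commonNbrs-comm x y = cong length (filter-≐ _ _ (swap , swap) (verts G))

  commonNbrs≡length-N⇒⊆ : ∀ {x y} → commonNbrs G x y ≡ length (N G x) → ∀ {w} → _~_ G x w → _~_ G y w
  commonNbrs≡length-N⇒⊆ {x} {y} eq {w} x~w = proj₂ (∈-filter⁻ (_~?_ G y) {xs = N G x} w∈)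
    where
    w∈ : w ∈ filter (_~?_ G y) (N G x)
    w∈ = subst (w ∈_) (sym (filter-complete (_~?_ G y) (trans (sym (commonNbrs≡length-filter-N x y)) eq)))
               (∈-filter⁺ (_~?_ G x) (complete G w) x~w)

  commonNbrs≡valency⇒sameNbrs : ∀ {k x y} → Regular G k → commonNbrs G x y ≡ k →
                                ∀ w → (_~_ G x w ⇔ _~_ G y w)
  commonNbrs≡valency⇒sameNbrs {k} {x} {y} reg eq w = mk⇔
    (commonNbrs≡length-N⇒⊆ (trans eq (sym (reg x))))
    (commonNbrs≡length-N⇒⊆ (trans (sym (commonNbrs-comm x y)) (trans eq (sym (reg y)))))

module _ (Γ Σ : Graph) where

  N-⊗ : ∀ u i → N (Γ ⊗ Σ) (u , i) ≡ cartesianProduct (N Γ u) (N Σ i)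
  N-⊗ u i = filter-cartesianProduct (_~?_ Γ u) (_~?_ Σ i) (verts Γ) (verts Σ)

  Regular-⊗ : ∀ {k l} → Regular Γ k → Regular Σ l → Regular (Γ ⊗ Σ) (k * l)
  Regular-⊗ regΓ regΣ (u , i) = begin
    length (N (Γ ⊗ Σ) (u , i))                 ≡⟨ cong length (N-⊗ u i) ⟩
    length (cartesianProduct (N Γ u) (N Σ i))  ≡⟨ length-cartesianProduct (N Γ u) (N Σ i) ⟩
    length (N Γ u) * length (N Σ i)            ≡⟨ cong₂ _*_ (regΓ u) (regΣ i) ⟩
    _                                          ∎
    where open ≡-Reasoning

  commonNbrs-⊗ : ∀ u v i j → commonNbrs (Γ ⊗ Σ) (u , i) (v , j) ≡ commonNbrs Γ u v * commonNbrs Σ i j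
  commonNbrs-⊗ u v i j = begin
    commonNbrs (Γ ⊗ Σ) (u , i) (v , j)
      ≡⟨ cong length (filter-≐ _ _ (interchange , interchange) (cartesianProduct (verts Γ) (verts Σ))) ⟩
    length (filter (λ z → both-Γ? (proj₁ z) ×-dec both-Σ? (proj₂ z)) (cartesianProduct (verts Γ) (verts Σ)))
      ≡⟨ cong length (filter-cartesianProduct both-Γ? both-Σ? (verts Γ) (verts Σ)) ⟩
    length (cartesianProduct (filter both-Γ? (verts Γ)) (filter both-Σ? (verts Σ)))
      ≡⟨ length-cartesianProduct (filter both-Γ? (verts Γ)) (filter both-Σ? (verts Σ)) ⟩
    commonNbrs Γ u v * commonNbrs Σ i j
      ∎
    where
    open ≡-Reasoning
    both-Γ? = λ w → _~?_ Γ u w ×-dec _~?_ Γ v w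
    both-Σ? = λ x → _~?_ Σ i x ×-dec _~?_ Σ j x
    interchange : ∀ {A B C D : Set} → (A × B) × (C × D) → (A × C) × (B × D)
    interchange ((a , b) , (c , d)) = (a , c) , (b , d)

lemma4p3 : (Γ Σ : Graph) (k l : ℕ) → Regular Γ k → Regular Σ l → gcd k l ≡ 1 →
    RThin Γ → (p q : V (Γ ⊗ Σ)) → InX Γ Σ l p q → ¬ (proj₂ p ≡ proj₂ q)
lemma4p3 Γ Σ k l regΓ regΣ gcd≡1 thin (u , i) (v , .i) (q≢p , nz , m , m>0 , eq) refl =
  q≢p (cong (_, i) (sym u≡v))
  where
  c = commonNbrs Γ u v
  scaled : l * (c * l) ≡ m * (k * l)
  scaled = subst₂ (λ s t → l * s ≡ m * t)
    (trans (commonNbrs-⊗ Γ Σ u v i i) (cong (c *_) (trans (commonNbrs-self Σ i) (regΣ i))))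
    (Regular-⊗ Γ Σ regΓ regΣ (u , i)) eq
  kl≢0 : NonZero (k * l)
  kl≢0 = subst NonZero (Regular-⊗ Γ Σ regΓ regΣ (u , i)) nz
  cancelled : l * c ≡ m * k
  cancelled = *-cancelʳ-≡ _ _ l ⦃ m*n≢0⇒n≢0 k ⦃ kl≢0 ⦄ ⦄
    (trans (*-assoc l c l) (trans scaled (sym (*-assoc m k l))))
  c≡k : c ≡ k
  c≡k = coprime-multiple-≤⇒≡ (gcd≡1⇒coprime gcd≡1) m>0 cancelled
    (subst (c ≤_) (regΓ u) (commonNbrs≤length-N Γ u v))
  u≡v : u ≡ v
  u≡v = thin u v (commonNbrs≡valency⇒sameNbrs Γ regΓ c≡k)
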